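{- Let $A$ be a type and $t$ a $\lambda\mu$-term. (1) If $\mathbb G\vdash^*t:A;\mathbb D$, then $t\in\mathbb I(A)$. (2) If $t\in\mathbb I(A)$, then $\mathbb G\vdash^*t:A;\mathbb D$.
   Context: $\lambda\mu$-terms over disjoint infinite sets of $\lambda$-variables and $\mu$-variables: $t ::= x \mid \lambda x.t \mid (t\,t) \mid \mu\alpha.t \mid (\alpha\,t)$. $u[\alpha:=^*v]$ replaces inductively each subterm $(\alpha\,w)$ of $u$ by $(\alpha\,(w\,v))$. Reduction $\triangleright$: compatible closure of $(\lambda x.u\;v)\triangleright u[x:=v]$ and $(\mu\alpha.u\;v)\triangleright\mu\alpha.u[\alpha:=^*v]$; $\triangleright^*$ its reflexive transitive closure. Types: $A ::= X\mid\perp\mid A\to A$ ($X$ in an infinite set $\mathcal P$ of propositional variables). Typing rules: (ax) $\Gamma\vdash x:A;\Delta$ if $x:A\in\Gamma$; ($\to_i$) from $\Gamma,x:A\vdash t:B;\Delta$ infer $\Gamma\vdash\lambda x.t:A\to B;\Delta$; ($\to_e$) from $\Gamma\vdash u:A\to B;\Delta$ and $\Gamma\vdash v:A;\Delta$ infer $\Gamma\vdash(u\,v):B;\Delta$; ($\mu$) from $\Gamma\vdash t:\perp;\Delta,\alpha:A$ infer $\Gamma\vdash\mu\alpha.t:A;\Delta$; ($\perp$) from $\Gamma\vdash t:A;\Delta,\alpha:A$ infer $\Gamma\vdash(\alpha\,t):\perp;\Delta,\alpha:A$. Setting: let $\mathbb V_1=\{x_i\mid i\in\mathbb N\}$ be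 an infinite set of $\lambda$-variables and $\mathbb V_2=\{\alpha_i\mid i\in\mathbb N\}$ an infinite set of $\mu$-variables, $\mathbb V=\mathbb V_1\cup\mathbb V_2$. Let $\{A_i\mid i\in\mathbb N\}$ and $\{B_i\mid i\in\mathbb N\}$ be enumerations of all types. $\mathbb G=\{x_i:A_i\mid i\in\mathbb N\}$, $\mathbb D=\{\alpha_i:B_i\mid i\in\mathbb N\}$. For a term $u$ with $FV(u)\subseteq\mathbb V$, $\mathbb G_u,\mathbb D_u$ are the restrictions of $\mathbb G,\mathbb D$ to declarations of variables in $FV(u)$; $\mathbb G\vdash u:C;\mathbb D$ means $FV(u)\subseteq\mathbb V$ and $\mathbb G_u\vdash u:C;\mathbb D_u$; $\mathbb G\vdash^*u:C;\mathbb D$ means there exists $u'$ with $u\triangleright^*u'$ and $\mathbb G\vdash u':C;\mathbb D$. Let $\{X_i\mid i\in\mathbb N\}$ enumerate $\{\perp\}\cup\mathcal P$ with $X_0=\perp$, and for $i\in\mathbb N$ let $\mathcal B_i=\{t\mid\mathbb G\vdash^*t:X_i;\mathbb D\}$. For sets of terms $\mathcal K,\mathcal L$, $\mathcal K\leadsto\mathcal L=\{t\mid\forall u\in\mathcal K,(t\,u)\in\mathcal L\}$. The interpretation $\mathbb I$ maps types to sets of terms by $\mathbb I(X_i)=\mathcal B_i$ for all $i$ (so $\mathbb I(\perp)=\mathcal B_0$) and $\mathbb I(A\to B)=\mathbb I(A)\leadsto\mathbb I(B)$. -}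

module Defs where

open import Data.Nat using (ℕ; zero; suc; _+_; _<ᵇ_; compare; less; equal; greater; _≟_)
open import Level using (Lift; 0ℓ) renaming (suc to lsuc)
open import Data.Bool using (if_then_else_)
open import Data.Product using (Σ; ∃; _×_; _,_)
open import Relation.Nullary using (yes; no)
open import Relation.Binary.PropositionalEquality using (_≡_)
open import Relation.Binary.Construct.Closure.ReflexiveTransitive using (Star)

-- λμ-terms, de Bruijn style with two separate index spaces:
-- λ-variables and μ-variables are natural numbers; a free variable is
-- a (top-level) index, so variable names = ℕ for each sort.
--   var n    : λ-variable n
--   lam t    : λx.t      (binds λ-index 0 in t)
--   app t u  : (t u)
--   mu t     : μα.t      (binds μ-index 0 in t)
--   nam k t  : (α_k t)   (α_k a μ-variable)

data Tm : Set where
  var : ℕ → Tm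
  lam : Tm → Tm
  app : Tm → Tm → Tm
  mu  : Tm → Tm
  nam : ℕ → Tm → Tm

data Ty : Set where
  atom : ℕ → Ty
  bot  : Ty
  _⇒_  : Ty → Ty → Ty

infixr 7 _⇒_

data _∈λ_ : ℕ → Tm → Set where
  var  : ∀ {n} → n ∈λ var n
  lam  : ∀ {n t} → suc n ∈λ t → n ∈λ lam t
  appl : ∀ {n t u} → n ∈λ t → n ∈λ app t u
  appr : ∀ {n t u} → n ∈λ u → n ∈λ app t u
  mu   : ∀ {n t} → n ∈λ t → n ∈λ mu t
  nam  : ∀ {n k t} → n ∈λ t → n ∈λ nam k t

data _∈μ_ : ℕ → Tm → Set where
  lam  : ∀ {n t} → n ∈μ t → n ∈μ lam t
  appl : ∀ {n t u} → n ∈μ t → n ∈μ app t u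
  appr : ∀ {n t u} → n ∈μ u → n ∈μ app t u
  mu   : ∀ {n t} → suc n ∈μ t → n ∈μ mu t
  namh : ∀ {n t} → n ∈μ nam n t
  namt : ∀ {n k t} → n ∈μ t → n ∈μ nam k t

shiftλ : ℕ → Tm → Tm
shiftλ c (var m)   = if m <ᵇ c then var m else var (suc m)
shiftλ c (lam t)   = lam (shiftλ (suc c) t)
shiftλ c (app t u) = app (shiftλ c t) (shiftλ c u)
shiftλ c (mu t)    = mu (shiftλ c t)
shiftλ c (nam k t) = nam k (shiftλ c t)

shiftμ : ℕ → Tm → Tm
shiftμ c (var m)   = var m
shiftμ c (lam t)   = lam (shiftμ c t)
shiftμ c (app t u) = app (shiftμ c t) (shiftμ c u)
shiftμ c (mu t)    = mu (shiftμ (suc c) t)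
shiftμ c (nam k t) = nam (if k <ᵇ c then k else suc k) (shiftμ c t)

-- Substitution t[n := s] (capture-avoiding; removes the λ-variable n)

substVar : ℕ → Tm → ℕ → Tm
substVar n s m with compare m n
... | less _ _      = var m
... | equal _       = s
... | greater _ k   = var (n + k)

subst : ℕ → Tm → Tm → Tm
subst n s (var m)   = substVar n s m
subst n s (lam t)   = lam (subst (suc n) (shiftλ 0 s) t)
subst n s (app t u) = app (subst n s t) (subst n s u)
subst n s (mu t)    = mu (subst n (shiftμ 0 s) t)
subst n s (nam k t) = nam k (subst n s t)

msubst : ℕ → Tm → Tm → Tm
msubst n v (var m)   = var m
msubst n v (lam t)   = lam (msubst n (shiftλ 0 v) t)
msubst n v (app t u) = app (msubst n v t) (msubst n v u)
msubst n v (mu t)    = mu (msubst (suc n) (shiftμ 0 v) t)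
msubst n v (nam k t) with k ≟ n
... | yes _ = nam k (app (msubst n v t) v)
... | no  _ = nam k (msubst n v t)

infix 4 _▷_ _▷*_

data _▷_ : Tm → Tm → Set where
  β    : ∀ {u v} → app (lam u) v ▷ subst 0 v u
  μr   : ∀ {u v} → app (mu u) v ▷ mu (msubst 0 (shiftμ 0 v) u)
  lam  : ∀ {t t'} → t ▷ t' → lam t ▷ lam t'
  appl : ∀ {t t' u} → t ▷ t' → app t u ▷ app t' u
  appr : ∀ {t u u'} → u ▷ u' → app t u ▷ app t u'
  mu   : ∀ {t t'} → t ▷ t' → mu t ▷ mu t'
  nam  : ∀ {k t t'} → t ▷ t' → nam k t ▷ nam k t'

_▷*_ : Tm → Tm → Set
_▷*_ = Star _▷_

Ctx : Set₁
Ctx = ℕ → Ty → Set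

ext : Ty → Ctx → Ctx
ext A Γ zero    B = B ≡ A
ext A Γ (suc n) B = Γ n B

data _⊢_∶_∣_ : Ctx → Tm → Ty → Ctx → Set₁ where
  ax  : ∀ {Γ Δ n A} → Γ n A → Γ ⊢ var n ∶ A ∣ Δ
  →i  : ∀ {Γ Δ t A B} → ext A Γ ⊢ t ∶ B ∣ Δ → Γ ⊢ lam t ∶ A ⇒ B ∣ Δ
  →e  : ∀ {Γ Δ u v A B} → Γ ⊢ u ∶ A ⇒ B ∣ Δ → Γ ⊢ v ∶ A ∣ Δ → Γ ⊢ app u v ∶ B ∣ Δ
  μi  : ∀ {Γ Δ t A} → Γ ⊢ t ∶ bot ∣ ext A Δ → Γ ⊢ mu t ∶ A ∣ Δ
  ⊥i  : ∀ {Γ Δ k t A} → Δ k A → Γ ⊢ t ∶ A ∣ Δ → Γ ⊢ nam k t ∶ bot ∣ Δ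

-- The setting: V₁ = {x i}, V₂ = {α i}, 𝔾 = {x i : A i}, 𝔻 = {α i : B i}.

module Setting (x α : ℕ → ℕ) (A B : ℕ → Ty) where

  𝔾 : Tm → Ctx
  𝔾 u n C = n ∈λ u × ∃ λ i → x i ≡ n × A i ≡ C

  𝔻 : Tm → Ctx
  𝔻 u n C = n ∈μ u × ∃ λ i → α i ≡ n × B i ≡ C

  FV⊆𝕍 : Tm → Set
  FV⊆𝕍 u = (∀ n → n ∈λ u → ∃ λ i → x i ≡ n) × (∀ n → n ∈μ u → ∃ λ i → α i ≡ n)

  _⊢𝔾𝔻_ : Tm → Ty → Set₁
  u ⊢𝔾𝔻 C = Lift (lsuc 0ℓ) (FV⊆𝕍 u) × (𝔾 u ⊢ u ∶ C ∣ 𝔻 u)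

  _⊢*𝔾𝔻_ : Tm → Ty → Set₁
  u ⊢*𝔾𝔻 C = Σ Tm λ u' → Lift (lsuc 0ℓ) (u ▷* u') × u' ⊢𝔾𝔻 C

  𝕀 : Ty → Tm → Set₁
  𝕀 (atom p) t = t ⊢*𝔾𝔻 atom p
  𝕀 bot      t = t ⊢*𝔾𝔻 bot
  𝕀 (C ⇒ D)  t = ∀ u → 𝕀 C u → 𝕀 D (app t u)

module Submission where

-- Both directions are proved simultaneously by induction on C.  For C ⇒ D, soundness just combines
-- reducts by (→e).  Completeness picks a variable x_i declared with type
-- C in 𝔾 (the A_i enumerate all types); then (t x_i) ∈ 𝕀(D), so some
-- reduct w of (t x_i) has type D, and it remains to "un-apply" x_i: to
-- find a reduct t' of t with type C ⇒ D (lemma unapply).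
--
-- A reduct of (t z) corresponds to a
-- reduct of t in which the pending argument z has been pushed into some
-- λ-bodies (by β) and into some named subterms (α w) (by μ-reduction).
-- The relation Sim/SimTop records this correspondence; it is preserved
-- by renaming, substitution and μ-substitution, hence every reduction
-- step on the applied side is matched by reductions on t (sim, simTop).
-- Typing then transfers backwards along the relation (typeBack), with
-- the μ-variables that received z typed A ⇒ _ instead of _.

open import Defs
open import Data.Nat using (ℕ; zero; suc; _<ᵇ_; compare; less; equal; greater; _≟_)
open import Data.Bool using (Bool; true; false; if_then_else_)
open import Data.Product using (Σ; ∃; _×_; _,_; proj₂)
open import Data.Empty using (⊥; ⊥-elim)
open import Relation.Nullary using (yes; no; ¬_)
open import Relation.Binary.PropositionalEquality as ≡
  using (_≡_; _≗_; refl; sym; trans; cong; cong₂)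
open import Relation.Binary.Construct.Closure.ReflexiveTransitive using (ε; _◅_; _◅◅_; gmap)
open import Function using (id; _∘_)
open import Function.Definitions using (Injective)
open import Level using (lift)

-- The
-- shifts and substitutions of Defs are instances of these, which lets
-- the simulation lemmas below be proved once for arbitrary renamings.

liftᵣ : (ℕ → ℕ) → ℕ → ℕ
liftᵣ f zero    = zero
liftᵣ f (suc m) = suc (f m)

cons : ∀ {X : Set} → X → (ℕ → X) → ℕ → X
cons a f zero    = a
cons a f (suc m) = f m

ren : (ℕ → ℕ) → Tm → Tm
ren f (var m)   = var (f m)
ren f (lam t)   = lam (ren (liftᵣ f) t)
ren f (app t u) = app (ren f t) (ren f u)
ren f (mu t)    = mu (ren f t)
ren f (nam k t) = nam k (ren f t)

renμ : (ℕ → ℕ) → Tm → Tm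
renμ h (var m)   = var m
renμ h (lam t)   = lam (renμ h t)
renμ h (app t u) = app (renμ h t) (renμ h u)
renμ h (mu t)    = mu (renμ (liftᵣ h) t)
renμ h (nam k t) = nam (h k) (renμ h t)

exts : (ℕ → Tm) → ℕ → Tm
exts σ zero    = var zero
exts σ (suc m) = ren suc (σ m)

sub : (ℕ → Tm) → Tm → Tm
sub σ (var m)   = σ m
sub σ (lam t)   = lam (sub (exts σ) t)
sub σ (app t u) = app (sub σ t) (sub σ u)
sub σ (mu t)    = mu (sub (renμ suc ∘ σ) t)
sub σ (nam k t) = nam k (sub σ t)

liftᵣ-cong : ∀ {f g} → f ≗ g → liftᵣ f ≗ liftᵣ g
liftᵣ-cong e zero    = refl
liftᵣ-cong e (suc m) = cong suc (e m)

ren-cong : ∀ {f g} → f ≗ g → ∀ t → ren f t ≡ ren g t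
ren-cong e (var m)   = cong var (e m)
ren-cong e (lam t)   = cong lam (ren-cong (liftᵣ-cong e) t)
ren-cong e (app t u) = cong₂ app (ren-cong e t) (ren-cong e u)
ren-cong e (mu t)    = cong mu (ren-cong e t)
ren-cong e (nam k t) = cong (nam k) (ren-cong e t)

renμ-cong : ∀ {f g} → f ≗ g → ∀ t → renμ f t ≡ renμ g t
renμ-cong e (var m)   = refl
renμ-cong e (lam t)   = cong lam (renμ-cong e t)
renμ-cong e (app t u) = cong₂ app (renμ-cong e t) (renμ-cong e u)
renμ-cong e (mu t)    = cong mu (renμ-cong (liftᵣ-cong e) t)
renμ-cong e (nam k t) = cong₂ nam (e k) (renμ-cong e t)

sub-cong : ∀ {σ τ} → σ ≗ τ → ∀ t → sub σ t ≡ sub τ t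
sub-cong e (var m)   = e m
sub-cong {σ} {τ} e (lam t) = cong lam (sub-cong e' t)
  where e' : exts σ ≗ exts τ
        e' zero    = refl
        e' (suc m) = cong (ren suc) (e m)
sub-cong e (app t u) = cong₂ app (sub-cong e t) (sub-cong e u)
sub-cong e (mu t)    = cong mu (sub-cong (cong (renμ suc) ∘ e) t)
sub-cong e (nam k t) = cong (nam k) (sub-cong e t)

liftᵣ-id : ∀ {f} → f ≗ id → liftᵣ f ≗ id
liftᵣ-id e zero    = refl
liftᵣ-id e (suc m) = cong suc (e m)

ren-id : ∀ {f} → f ≗ id → ∀ t → ren f t ≡ t
ren-id e (var m)   = cong var (e m)
ren-id e (lam t)   = cong lam (ren-id (liftᵣ-id e) t)
ren-id e (app t u) = cong₂ app (ren-id e t) (ren-id e u)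
ren-id e (mu t)    = cong mu (ren-id e t)
ren-id e (nam k t) = cong (nam k) (ren-id e t)

sub-id : ∀ {σ} → σ ≗ var → ∀ t → sub σ t ≡ t
sub-id e (var m)   = e m
sub-id {σ} e (lam t) = cong lam (sub-id e' t)
  where e' : exts σ ≗ var
        e' zero    = refl
        e' (suc m) = cong (ren suc) (e m)
sub-id e (app t u) = cong₂ app (sub-id e t) (sub-id e u)
sub-id e (mu t)    = cong mu (sub-id (cong (renμ suc) ∘ e) t)
sub-id e (nam k t) = cong (nam k) (sub-id e t)

shiftIndex : ℕ → ℕ → ℕ
shiftIndex c m = if m <ᵇ c then m else suc m

shiftIndex-suc : ∀ c → shiftIndex (suc c) ≗ liftᵣ (shiftIndex c)
shiftIndex-suc c zero = refl
shiftIndex-suc c (suc m) with m <ᵇ c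
... | true  = refl
... | false = refl

shiftλ≡ren : ∀ c t → shiftλ c t ≡ ren (shiftIndex c) t
shiftλ≡ren c (var m) with m <ᵇ c
... | true  = refl
... | false = refl
shiftλ≡ren c (lam t)   = cong lam (trans (shiftλ≡ren (suc c) t) (ren-cong (shiftIndex-suc c) t))
shiftλ≡ren c (app t u) = cong₂ app (shiftλ≡ren c t) (shiftλ≡ren c u)
shiftλ≡ren c (mu t)    = cong mu (shiftλ≡ren c t)
shiftλ≡ren c (nam k t) = cong (nam k) (shiftλ≡ren c t)

shiftμ≡renμ : ∀ c t → shiftμ c t ≡ renμ (shiftIndex c) t
shiftμ≡renμ c (var m)   = refl
shiftμ≡renμ c (lam t)   = cong lam (shiftμ≡renμ c t)
shiftμ≡renμ c (app t u) = cong₂ app (shiftμ≡renμ c t) (shiftμ≡renμ c u)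
shiftμ≡renμ c (mu t)    = cong mu (trans (shiftμ≡renμ (suc c) t) (renμ-cong (shiftIndex-suc c) t))
shiftμ≡renμ c (nam k t) = cong (nam _) (shiftμ≡renμ c t)

shiftλ0 : ∀ t → shiftλ 0 t ≡ ren suc t
shiftλ0 = shiftλ≡ren 0

shiftμ0 : ∀ t → shiftμ 0 t ≡ renμ suc t
shiftμ0 = shiftμ≡renμ 0

subst≡sub : ∀ n s t → subst n s t ≡ sub (substVar n s) t
subst≡sub n s (var m)   = refl
subst≡sub n s (lam t)   = cong lam (trans (subst≡sub (suc n) (shiftλ 0 s) t) (sub-cong underλ t))
  where underλ : substVar (suc n) (shiftλ 0 s) ≗ exts (substVar n s)
        underλ zero = refl
        underλ (suc m) with compare m n
        ... | less _ _    = refl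
        ... | equal _     = shiftλ0 s
        ... | greater _ _ = refl
subst≡sub n s (app t u) = cong₂ app (subst≡sub n s t) (subst≡sub n s u)
subst≡sub n s (mu t)    = cong mu (trans (subst≡sub n (shiftμ 0 s) t) (sub-cong underμ t))
  where underμ : substVar n (shiftμ 0 s) ≗ renμ suc ∘ substVar n s
        underμ m with compare m n
        ... | less _ _    = refl
        ... | equal _     = shiftμ0 s
        ... | greater _ _ = refl
subst≡sub n s (nam k t) = cong (nam k) (subst≡sub n s t)

-- Fix the λ-variable z that t is applied to.
-- Sim ρ M z q r says that r arises from q (a reduct of t) by handing z
-- to the μ-variables marked by M: every named subterm (α q') with α
-- marked corresponds to (α r') with SimTop q' r', i.e. r' is q' applied
-- to z, or the result of firing that application (β for q' = λy.q'',
-- binding y to z; μ for q' = μβ.q'', marking β).  ρ translates the free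
-- λ-variables of q into those of r.

data Sim : (ℕ → ℕ) → (ℕ → Bool) → ℕ → Tm → Tm → Set
data SimTop (ρ : ℕ → ℕ) (M : ℕ → Bool) (z : ℕ) : Tm → Tm → Set

data Sim where
  ∼var    : ∀ {ρ M z m} → Sim ρ M z (var m) (var (ρ m))
  ∼lam    : ∀ {ρ M z q r} → Sim (liftᵣ ρ) M (suc z) q r → Sim ρ M z (lam q) (lam r)
  ∼app    : ∀ {ρ M z q₁ r₁ q₂ r₂} → Sim ρ M z q₁ r₁ → Sim ρ M z q₂ r₂ →
            Sim ρ M z (app q₁ q₂) (app r₁ r₂)
  ∼mu     : ∀ {ρ M z q r} → Sim ρ (cons false M) z q r → Sim ρ M z (mu q) (mu r)
  ∼nam    : ∀ {ρ M z k q r} → M k ≡ false → Sim ρ M z q r → Sim ρ M z (nam k q) (nam k r)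
  ∼marked : ∀ {ρ M z k q r} → M k ≡ true → SimTop ρ M z q r → Sim ρ M z (nam k q) (nam k r)

data SimTop ρ M z where
  applied : ∀ {q r} → Sim ρ M z q r → SimTop ρ M z q (app r (var z))
  bound   : ∀ {q r} → Sim (cons z ρ) M z q r → SimTop ρ M z (lam q) r
  passed  : ∀ {q r} → Sim ρ (cons true M) z q r → SimTop ρ M z (mu q) (mu r)

marked-unmarked : ∀ {M : ℕ → Bool} {k} → M k ≡ true → M k ≡ false → ⊥
marked-unmarked mk mb with trans (sym mk) mb
... | ()

Sim-ren : ∀ {ρ M z q r} → Sim ρ M z q r → ∀ f g {ρ' z'} →
          (∀ m → g (ρ m) ≡ ρ' (f m)) → g z ≡ z' → Sim ρ' M z' (ren f q) (ren g r)
Top-ren : ∀ {ρ M z q r} → SimTop ρ M z q r → ∀ f g {ρ' z'} →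
          (∀ m → g (ρ m) ≡ ρ' (f m)) → g z ≡ z' → SimTop ρ' M z' (ren f q) (ren g r)

Sim-ren {M = M} (∼var {m = m}) f g {ρ'} {z'} h ez =
  ≡.subst (λ w → Sim ρ' M z' (var (f m)) (var w)) (sym (h m)) ∼var
Sim-ren {ρ = ρ} (∼lam Rq) f g {ρ'} h ez = ∼lam (Sim-ren Rq (liftᵣ f) (liftᵣ g) h' (cong suc ez))
  where h' : ∀ m → liftᵣ g (liftᵣ ρ m) ≡ liftᵣ ρ' (liftᵣ f m)
        h' zero    = refl
        h' (suc m) = cong suc (h m)
Sim-ren (∼app R₁ R₂)    f g h ez = ∼app (Sim-ren R₁ f g h ez) (Sim-ren R₂ f g h ez)
Sim-ren (∼mu Rq)        f g h ez = ∼mu (Sim-ren Rq f g h ez)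
Sim-ren (∼nam mk Rq)    f g h ez = ∼nam mk (Sim-ren Rq f g h ez)
Sim-ren (∼marked mk T)  f g h ez = ∼marked mk (Top-ren T f g h ez)

Top-ren {M = M} (applied {q} {r} Rq) f g {ρ'} {z'} h ez =
  ≡.subst (λ w → SimTop ρ' M z' (ren f q) (app (ren g r) (var w))) (sym ez) (applied (Sim-ren Rq f g h ez))
Top-ren {ρ = ρ} {z = z} (bound Rq) f g {ρ'} {z'} h ez = bound (Sim-ren Rq (liftᵣ f) g h' ez)
  where h' : ∀ m → g (cons z ρ m) ≡ cons z' ρ' (liftᵣ f m)
        h' zero    = ez
        h' (suc m) = h m
Top-ren (passed Rq) f g h ez = passed (Sim-ren Rq f g h ez)

-- Weakening by a fresh λ-binder on both sides, or on the source side only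
-- (a binder which, on the target side, has been instantiated by z).
Sim-weaken : ∀ {ρ M z q r} → Sim ρ M z q r → Sim (liftᵣ ρ) M (suc z) (ren suc q) (ren suc r)
Sim-weaken R = Sim-ren R suc suc (λ _ → refl) refl

Sim-weakenSource : ∀ {ρ M z q r} → Sim ρ M z q r → Sim (cons z ρ) M z (ren suc q) r
Sim-weakenSource {ρ} {M} {z} {q} {r} R =
  ≡.subst (Sim (cons z ρ) M z (ren suc q)) (ren-id (λ _ → refl) r) (Sim-ren R suc id (λ _ → refl) refl)

Sim-renμ : ∀ {ρ M z q r} → Sim ρ M z q r → ∀ h {M'} → (∀ k → M' (h k) ≡ M k) →
           Sim ρ M' z (renμ h q) (renμ h r)
Top-renμ : ∀ {ρ M z q r} → SimTop ρ M z q r → ∀ h {M'} → (∀ k → M' (h k) ≡ M k) →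
           SimTop ρ M' z (renμ h q) (renμ h r)

cons-liftᵣ : ∀ {M M' : ℕ → Bool} {h} → (∀ k → M' (h k) ≡ M k) →
             ∀ b k → cons b M' (liftᵣ h k) ≡ cons b M k
cons-liftᵣ e b zero    = refl
cons-liftᵣ e b (suc k) = e k

Sim-renμ ∼var            h e = ∼var
Sim-renμ (∼lam Rq)       h e = ∼lam (Sim-renμ Rq h e)
Sim-renμ (∼app R₁ R₂)    h e = ∼app (Sim-renμ R₁ h e) (Sim-renμ R₂ h e)
Sim-renμ (∼mu Rq)        h e = ∼mu (Sim-renμ Rq (liftᵣ h) (cons-liftᵣ e false))
Sim-renμ (∼nam {k = k} mk Rq)    h e = ∼nam (trans (e k) mk) (Sim-renμ Rq h e)
Sim-renμ (∼marked {k = k} mk T) h e = ∼marked (trans (e k) mk) (Top-renμ T h e)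

Top-renμ (applied Rq) h e = applied (Sim-renμ Rq h e)
Top-renμ (bound Rq)   h e = bound (Sim-renμ Rq h e)
Top-renμ (passed Rq)  h e = passed (Sim-renμ Rq (liftᵣ h) (cons-liftᵣ e true))

Sim-weakenμ : ∀ {ρ M z q r} b → Sim ρ M z q r → Sim ρ (cons b M) z (renμ suc q) (renμ suc r)
Sim-weakenμ b R = Sim-renμ R suc (λ _ → refl)

Sim-sub : ∀ {ρ M z q r} → Sim ρ M z q r → ∀ σq σr {ρ' z'} →
          (∀ m → Sim ρ' M z' (σq m) (σr (ρ m))) → σr z ≡ var z' →
          Sim ρ' M z' (sub σq q) (sub σr r)
Top-sub : ∀ {ρ M z q r} → SimTop ρ M z q r → ∀ σq σr {ρ' z'} →
          (∀ m → Sim ρ' M z' (σq m) (σr (ρ m))) → σr z ≡ var z' →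
          SimTop ρ' M z' (sub σq q) (sub σr r)

Sim-sub (∼var {m = m}) σq σr c ez = c m
Sim-sub {ρ = ρ} {M = M} (∼lam Rq) σq σr {ρ'} {z'} c ez =
  ∼lam (Sim-sub Rq (exts σq) (exts σr) c' (cong (ren suc) ez))
  where c' : ∀ m → Sim (liftᵣ ρ') M (suc z') (exts σq m) (exts σr (liftᵣ ρ m))
        c' zero    = ∼var
        c' (suc m) = Sim-weaken (c m)
Sim-sub (∼app R₁ R₂) σq σr c ez = ∼app (Sim-sub R₁ σq σr c ez) (Sim-sub R₂ σq σr c ez)
Sim-sub (∼mu Rq) σq σr c ez =
  ∼mu (Sim-sub Rq (renμ suc ∘ σq) (renμ suc ∘ σr) (Sim-weakenμ false ∘ c) (cong (renμ suc) ez))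
Sim-sub (∼nam mk Rq)   σq σr c ez = ∼nam mk (Sim-sub Rq σq σr c ez)
Sim-sub (∼marked mk T) σq σr c ez = ∼marked mk (Top-sub T σq σr c ez)

Top-sub {M = M} (applied {q} {r} Rq) σq σr {ρ'} {z'} c ez =
  ≡.subst (λ w → SimTop ρ' M z' (sub σq q) (app (sub σr r) w)) (sym ez) (applied (Sim-sub Rq σq σr c ez))
Top-sub {ρ = ρ} {M = M} {z = z} (bound Rq) σq σr {ρ'} {z'} c ez = bound (Sim-sub Rq (exts σq) σr c' ez)
  where c' : ∀ m → Sim (cons z' ρ') M z' (exts σq m) (σr (cons z ρ m))
        c' zero    = ≡.subst (Sim (cons z' ρ') M z' (var 0)) (sym ez) ∼var
        c' (suc m) = Sim-weakenSource (c m)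
Top-sub (passed Rq) σq σr c ez =
  passed (Sim-sub Rq (renμ suc ∘ σq) (renμ suc ∘ σr) (Sim-weakenμ true ∘ c) (cong (renμ suc) ez))

Sim-shiftλ : ∀ {ρ M z q r} → Sim ρ M z q r → Sim (liftᵣ ρ) M (suc z) (shiftλ 0 q) (shiftλ 0 r)
Sim-shiftλ {ρ} {M} {z} {q} {r} R =
  ≡.subst₂ (Sim (liftᵣ ρ) M (suc z)) (sym (shiftλ0 q)) (sym (shiftλ0 r)) (Sim-weaken R)

Sim-shiftλSource : ∀ {ρ M z q r} → Sim ρ M z q r → Sim (cons z ρ) M z (shiftλ 0 q) r
Sim-shiftλSource {ρ} {M} {z} {q} {r} R =
  ≡.subst (λ w → Sim (cons z ρ) M z w r) (sym (shiftλ0 q)) (Sim-weakenSource R)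

Sim-shiftμ : ∀ {ρ M z q r} b → Sim ρ M z q r → Sim ρ (cons b M) z (shiftμ 0 q) (shiftμ 0 r)
Sim-shiftμ {ρ} {M} {z} {q} {r} b R =
  ≡.subst₂ (Sim ρ (cons b M) z) (sym (shiftμ0 q)) (sym (shiftμ0 r)) (Sim-weakenμ b R)

Sim-msubst : ∀ {ρ M z q r wq wr} b → Sim ρ M z q r → Sim ρ M z wq wr → M b ≡ false →
             Sim ρ M z (msubst b wq q) (msubst b wr r)
Top-msubst : ∀ {ρ M z q r wq wr} b → SimTop ρ M z q r → Sim ρ M z wq wr → M b ≡ false →
             SimTop ρ M z (msubst b wq q) (msubst b wr r)

Sim-msubst b ∼var Rw mb = ∼var
Sim-msubst b (∼lam Rq) Rw mb = ∼lam (Sim-msubst b Rq (Sim-shiftλ Rw) mb)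
Sim-msubst b (∼app R₁ R₂) Rw mb = ∼app (Sim-msubst b R₁ Rw mb) (Sim-msubst b R₂ Rw mb)
Sim-msubst b (∼mu Rq) Rw mb = ∼mu (Sim-msubst (suc b) Rq (Sim-shiftμ false Rw) mb)
Sim-msubst b (∼nam {k = k} mk Rq) Rw mb with k ≟ b
... | yes refl = ∼nam mk (∼app (Sim-msubst b Rq Rw mb) Rw)
... | no _     = ∼nam mk (Sim-msubst b Rq Rw mb)
Sim-msubst {M = M} b (∼marked {k = k} mk T) Rw mb with k ≟ b
... | yes refl = ⊥-elim (marked-unmarked {M} mk mb)
... | no _     = ∼marked mk (Top-msubst b T Rw mb)

Top-msubst b (applied Rq) Rw mb = applied (Sim-msubst b Rq Rw mb)
Top-msubst b (bound Rq)  Rw mb = bound (Sim-msubst b Rq (Sim-shiftλSource Rw) mb)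
Top-msubst b (passed Rq) Rw mb = passed (Sim-msubst (suc b) Rq (Sim-shiftμ true Rw) mb)

-- Marking a μ-variable α_b on the source side corresponds to handing it
-- z on the target side: u ↦ u[α_b :=* z].  M' is M with b turned on.
Sim-mark : ∀ {ρ M z q r} → Sim ρ M z q r → ∀ b {M'} → M b ≡ false → M' b ≡ true →
           (∀ j → ¬ j ≡ b → M' j ≡ M j) → Sim ρ M' z q (msubst b (var z) r)
Top-mark : ∀ {ρ M z q r} → SimTop ρ M z q r → ∀ b {M'} → M b ≡ false → M' b ≡ true →
           (∀ j → ¬ j ≡ b → M' j ≡ M j) → SimTop ρ M' z q (msubst b (var z) r)

cons-agree : ∀ {M M' : ℕ → Bool} {b} → (∀ j → ¬ j ≡ b → M' j ≡ M j) →
             ∀ c j → ¬ j ≡ suc b → cons c M' j ≡ cons c M j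
cons-agree oth c zero    ne = refl
cons-agree oth c (suc j) ne = oth j (ne ∘ cong suc)

Sim-mark ∼var b mb m'b oth = ∼var
Sim-mark (∼lam Rq) b mb m'b oth = ∼lam (Sim-mark Rq b mb m'b oth)
Sim-mark (∼app R₁ R₂) b mb m'b oth = ∼app (Sim-mark R₁ b mb m'b oth) (Sim-mark R₂ b mb m'b oth)
Sim-mark (∼mu Rq) b mb m'b oth = ∼mu (Sim-mark Rq (suc b) mb m'b (cons-agree oth false))
Sim-mark (∼nam {k = k} mk Rq) b mb m'b oth with k ≟ b
... | yes refl = ∼marked m'b (applied (Sim-mark Rq b mb m'b oth))
... | no ne    = ∼nam (trans (oth k ne) mk) (Sim-mark Rq b mb m'b oth)
Sim-mark {M = M} (∼marked {k = k} mk T) b mb m'b oth with k ≟ b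
... | yes refl = ⊥-elim (marked-unmarked {M} mk mb)
... | no ne    = ∼marked (trans (oth k ne) mk) (Top-mark T b mb m'b oth)

Top-mark (applied Rq) b mb m'b oth = applied (Sim-mark Rq b mb m'b oth)
Top-mark (bound Rq)   b mb m'b oth = bound (Sim-mark Rq b mb m'b oth)
Top-mark (passed Rq)  b mb m'b oth = passed (Sim-mark Rq (suc b) mb m'b (cons-agree oth true))

Sim-refl : ∀ t {ρ M z} → ρ ≗ id → (∀ k → M k ≡ false) → Sim ρ M z t t
Sim-refl (var m) {ρ} {M} {z} e mf = ≡.subst (λ w → Sim ρ M z (var m) (var w)) (e m) ∼var
Sim-refl (lam t)   e mf = ∼lam (Sim-refl t (liftᵣ-id e) mf)
Sim-refl (app t u) e mf = ∼app (Sim-refl t e mf) (Sim-refl u e mf)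
Sim-refl (mu t) {M = M} e mf = ∼mu (Sim-refl t e unmarked)
  where unmarked : ∀ k → cons false M k ≡ false
        unmarked zero    = refl
        unmarked (suc k) = mf k
Sim-refl (nam k t) e mf = ∼nam (mf k) (Sim-refl t e mf)

Sim-β : ∀ {ρ M z q₁ r₁ q₂ r₂} → Sim (liftᵣ ρ) M (suc z) q₁ r₁ → Sim ρ M z q₂ r₂ →
        Sim ρ M z (subst 0 q₂ q₁) (subst 0 r₂ r₁)
Sim-β {ρ} {M} {z} {q₁} {r₁} {q₂} {r₂} R₁ R₂ =
  ≡.subst₂ (Sim ρ M z) (sym (subst≡sub 0 q₂ q₁)) (sym (subst≡sub 0 r₂ r₁))
           (Sim-sub R₁ (substVar 0 q₂) (substVar 0 r₂) c refl)
  where c : ∀ m → Sim ρ M z (substVar 0 q₂ m) (substVar 0 r₂ (liftᵣ ρ m))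
        c zero    = R₂
        c (suc m) = ∼var

-- Firing (λy.r) z on the target side binds y to z: the source λ stays.
Sim-bindArg : ∀ {ρ M z q r} → Sim (liftᵣ ρ) M (suc z) q r → Sim (cons z ρ) M z q (subst 0 (var z) r)
Sim-bindArg {ρ} {M} {z} {q} {r} R =
  ≡.subst₂ (Sim (cons z ρ) M z) (sub-id (λ _ → refl) q) (sym (subst≡sub 0 (var z) r))
           (Sim-sub R var (substVar 0 (var z)) c refl)
  where c : ∀ m → Sim (cons z ρ) M z (var m) (substVar 0 (var z) (liftᵣ ρ m))
        c zero    = ∼var
        c (suc m) = ∼var

-- Firing (μβ.r) z on the target side hands z to β: the source μ stays, β is marked.
Sim-passArg : ∀ {ρ M z q r} → Sim ρ (cons false M) z q r → Sim ρ (cons true M) z q (msubst 0 (var z) r)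
Sim-passArg {M = M} R = Sim-mark R 0 refl refl agree
  where agree : ∀ j → ¬ j ≡ 0 → cons true M j ≡ cons false M j
        agree zero    ne = ⊥-elim (ne refl)
        agree (suc j) ne = refl

sim : ∀ {ρ M z q r r'} → Sim ρ M z q r → r ▷ r' → Σ Tm λ q' → q ▷* q' × Sim ρ M z q' r'
simTop : ∀ {ρ M z q r r'} → SimTop ρ M z q r → r ▷ r' → Σ Tm λ q' → q ▷* q' × SimTop ρ M z q' r'

sim (∼app (∼lam R₁) R₂) β  = _ , β ◅ ε , Sim-β R₁ R₂
sim (∼app (∼mu R₁) R₂) μr = _ , μr ◅ ε , ∼mu (Sim-msubst 0 R₁ (Sim-shiftμ false R₂) refl)
sim (∼lam Rq) (lam s) with sim Rq s
... | q' , st , R' = lam q' , gmap lam lam st , ∼lam R'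
sim (∼app {q₂ = q₂} R₁ R₂) (appl s) with sim R₁ s
... | q' , st , R' = app q' q₂ , gmap (λ a → app a q₂) appl st , ∼app R' R₂
sim (∼app {q₁ = q₁} R₁ R₂) (appr s) with sim R₂ s
... | q' , st , R' = app q₁ q' , gmap (app q₁) appr st , ∼app R₁ R'
sim (∼mu Rq) (mu s) with sim Rq s
... | q' , st , R' = mu q' , gmap mu mu st , ∼mu R'
sim (∼nam {k = k} mk Rq) (nam s) with sim Rq s
... | q' , st , R' = nam k q' , gmap (nam k) nam st , ∼nam mk R'
sim (∼marked {k = k} mk T) (nam s) with simTop T s
... | q' , st , T' = nam k q' , gmap (nam k) nam st , ∼marked mk T'

simTop (applied (∼lam Rp)) β  = _ , ε , bound (Sim-bindArg Rp)
simTop (applied (∼mu Rp))  μr = _ , ε , passed (Sim-passArg Rp)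
simTop (applied Rq) (appl s) with sim Rq s
... | q' , st , R' = q' , st , applied R'
simTop (applied Rq) (appr ())
simTop (bound Rq) s with sim Rq s
... | q' , st , R' = lam q' , gmap lam lam st , bound R'
simTop (passed Rq) (mu s) with sim Rq s
... | q' , st , R' = mu q' , gmap mu mu st , passed R'

simTop* : ∀ {ρ M z q r w} → SimTop ρ M z q r → r ▷* w → Σ Tm λ q' → q ▷* q' × SimTop ρ M z q' w
simTop* T ε = _ , ε , T
simTop* T (s ◅ ss) with simTop T s
... | q₁ , st₁ , T₁ with simTop* T₁ ss
... | q₂ , st₂ , T₂ = q₂ , st₁ ◅◅ st₂ , T₂

-- Transfer A ρ M z Γ Δ Γq Δq
-- says how the contexts of the target (Γ, Δ) determine those of the
-- source (Γq, Δq): z has type A, λ-variables are translated by ρ, and a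
-- marked μ-variable of type C in Δ has type A ⇒ C in Δq (it has not yet
-- received its argument z).
record Transfer (A : Ty) (ρ : ℕ → ℕ) (M : ℕ → Bool) (z : ℕ) (Γ Δ Γq Δq : Ctx) : Set where
  field
    arg      : ∀ C → Γ z C → C ≡ A
    vars     : ∀ m C → Γ (ρ m) C → Γq m C
    unmarked : ∀ k C → M k ≡ false → Δ k C → Δq k C
    marked   : ∀ k C → M k ≡ true → Δ k C → Δq k (A ⇒ C)

open Transfer

Transfer-lam : ∀ {A ρ M z Γ Δ Γq Δq} C → Transfer A ρ M z Γ Δ Γq Δq →
               Transfer A (liftᵣ ρ) M (suc z) (ext C Γ) Δ (ext C Γq) Δq
Transfer-lam C T .arg          = arg T
Transfer-lam C T .vars zero    = λ _ g → g
Transfer-lam C T .vars (suc m) = vars T m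
Transfer-lam C T .unmarked     = unmarked T
Transfer-lam C T .marked       = marked T

Transfer-bind : ∀ {A ρ M z Γ Δ Γq Δq} → Transfer A ρ M z Γ Δ Γq Δq →
                Transfer A (cons z ρ) M z Γ Δ (ext A Γq) Δq
Transfer-bind T .arg          = arg T
Transfer-bind T .vars zero    = arg T
Transfer-bind T .vars (suc m) = vars T m
Transfer-bind T .unmarked     = unmarked T
Transfer-bind T .marked       = marked T

Transfer-mu : ∀ {A ρ M z Γ Δ Γq Δq} C → Transfer A ρ M z Γ Δ Γq Δq →
              Transfer A ρ (cons false M) z Γ (ext C Δ) Γq (ext C Δq)
Transfer-mu C T .arg              = arg T
Transfer-mu C T .vars             = vars T
Transfer-mu C T .unmarked zero    = λ _ _ d → d
Transfer-mu C T .unmarked (suc k) = unmarked T k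
Transfer-mu C T .marked zero _ ()
Transfer-mu C T .marked (suc k)   = marked T k

Transfer-pass : ∀ {A ρ M z Γ Δ Γq Δq} C → Transfer A ρ M z Γ Δ Γq Δq →
                Transfer A ρ (cons true M) z Γ (ext C Δ) Γq (ext (A ⇒ C) Δq)
Transfer-pass C T .arg              = arg T
Transfer-pass C T .vars             = vars T
Transfer-pass C T .unmarked zero _ ()
Transfer-pass C T .unmarked (suc k) = unmarked T k
Transfer-pass {A} C T .marked zero  = λ _ _ d → cong (A ⇒_) d
Transfer-pass C T .marked (suc k)   = marked T k

typeBack : ∀ {A ρ M z q r Γ Δ Γq Δq C} → Sim ρ M z q r → Γ ⊢ r ∶ C ∣ Δ →
           Transfer A ρ M z Γ Δ Γq Δq → Γq ⊢ q ∶ C ∣ Δq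
typeBackTop : ∀ {A ρ M z q r Γ Δ Γq Δq C} → SimTop ρ M z q r → Γ ⊢ r ∶ C ∣ Δ →
              Transfer A ρ M z Γ Δ Γq Δq → Γq ⊢ q ∶ A ⇒ C ∣ Δq

typeBack ∼var (ax g) T = ax (vars T _ _ g)
typeBack (∼lam Rq) (→i {A = C} D) T = →i (typeBack Rq D (Transfer-lam C T))
typeBack (∼app R₁ R₂) (→e D₁ D₂) T = →e (typeBack R₁ D₁ T) (typeBack R₂ D₂ T)
typeBack (∼mu Rq) (μi {A = C} D) T = μi (typeBack Rq D (Transfer-mu C T))
typeBack (∼nam mk Rq) (⊥i d D) T = ⊥i (unmarked T _ _ mk d) (typeBack Rq D T)
typeBack (∼marked mk Tq) (⊥i d D) T = ⊥i (marked T _ _ mk d) (typeBackTop Tq D T)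

typeBackTop {Γ = Γ} {Δ} {C = C} (applied {r = r} Rq) (→e D (ax g)) T =
  typeBack Rq (≡.subst (λ A' → Γ ⊢ r ∶ A' ⇒ C ∣ Δ) (arg T _ g) D) T
typeBackTop (bound Rq) D T = →i (typeBack Rq D (Transfer-bind T))
typeBackTop {C = C} (passed Rq) (μi D) T = μi (typeBack Rq D (Transfer-pass C T))

unapply : ∀ {Γ Δ t w z D} A → (∀ C → Γ z C → C ≡ A) → app t (var z) ▷* w → Γ ⊢ w ∶ D ∣ Δ →
          Σ Tm λ t' → t ▷* t' × Γ ⊢ t' ∶ A ⇒ D ∣ Δ
unapply {Γ} {Δ} {t} {z = z} A zA red D with simTop* (applied start) red
  where start : Sim id (λ _ → false) z t t
        start = Sim-refl t (λ _ → refl) (λ _ → refl)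
... | t' , st , T = t' , st , typeBackTop T D transfer
  where transfer : Transfer A id (λ _ → false) z Γ Δ Γ Δ
        transfer .arg          = zA
        transfer .vars m C g   = g
        transfer .unmarked k C _ d = d
        transfer .marked k C ()

⊢-restrict : ∀ {Γ Δ Γ' Δ' t C} → Γ ⊢ t ∶ C ∣ Δ → (∀ n C → n ∈λ t → Γ n C → Γ' n C) →
             (∀ n C → n ∈μ t → Δ n C → Δ' n C) → Γ' ⊢ t ∶ C ∣ Δ'
⊢-restrict (ax g) hΓ hΔ = ax (hΓ _ _ var g)
⊢-restrict {Γ} {Γ' = Γ'} {t = lam t} (→i {A = A} D) hΓ hΔ = →i (⊢-restrict D hΓ' (λ n C i → hΔ n C (lam i)))
  where hΓ' : ∀ n C → n ∈λ t → ext A Γ n C → ext A Γ' n C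
        hΓ' zero    C i g = g
        hΓ' (suc n) C i g = hΓ n C (lam i) g
⊢-restrict (→e D₁ D₂) hΓ hΔ =
  →e (⊢-restrict D₁ (λ n C i → hΓ n C (appl i)) (λ n C i → hΔ n C (appl i)))
     (⊢-restrict D₂ (λ n C i → hΓ n C (appr i)) (λ n C i → hΔ n C (appr i)))
⊢-restrict {Δ = Δ} {Δ' = Δ'} {t = mu t} (μi {A = A} D) hΓ hΔ = μi (⊢-restrict D (λ n C i → hΓ n C (mu i)) hΔ')
  where hΔ' : ∀ n C → n ∈μ t → ext A Δ n C → ext A Δ' n C
        hΔ' zero    C i d = d
        hΔ' (suc n) C i d = hΔ n C (mu i) d
⊢-restrict (⊥i d D) hΓ hΔ =
  ⊥i (hΔ _ _ namh d) (⊢-restrict D (λ n C i → hΓ n C (nam i)) (λ n C i → hΔ n C (namt i)))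

⊢-declaredλ : ∀ {Γ Δ t C n} → Γ ⊢ t ∶ C ∣ Δ → n ∈λ t → ∃ λ C' → Γ n C'
⊢-declaredλ (ax g)     var      = _ , g
⊢-declaredλ (→i D)     (lam i)  = ⊢-declaredλ D i
⊢-declaredλ (→e D₁ D₂) (appl i) = ⊢-declaredλ D₁ i
⊢-declaredλ (→e D₁ D₂) (appr i) = ⊢-declaredλ D₂ i
⊢-declaredλ (μi D)     (mu i)   = ⊢-declaredλ D i
⊢-declaredλ (⊥i d D)   (nam i)  = ⊢-declaredλ D i

⊢-declaredμ : ∀ {Γ Δ t C n} → Γ ⊢ t ∶ C ∣ Δ → n ∈μ t → ∃ λ C' → Δ n C'
⊢-declaredμ (→i D)     (lam i)  = ⊢-declaredμ D i
⊢-declaredμ (→e D₁ D₂) (appl i) = ⊢-declaredμ D₁ i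
⊢-declaredμ (→e D₁ D₂) (appr i) = ⊢-declaredμ D₂ i
⊢-declaredμ (μi D)     (mu i)   = ⊢-declaredμ D i
⊢-declaredμ (⊥i d D)   namh     = _ , d
⊢-declaredμ (⊥i d D)   (namt i) = ⊢-declaredμ D i

-- The setting of the lemma.
module Adequacy (x α : ℕ → ℕ) (x-inj : Injective _≡_ _≡_ x) (A B : ℕ → Ty)
                (A-onto : ∀ C → ∃ λ i → A i ≡ C) where
  open Setting x α A B

  𝔾∞ : Ctx
  𝔾∞ n C = ∃ λ i → x i ≡ n × A i ≡ C

  𝔻∞ : Ctx
  𝔻∞ n C = ∃ λ i → α i ≡ n × B i ≡ C

  ⊢𝔾𝔻-intro : ∀ {u C} → 𝔾∞ ⊢ u ∶ C ∣ 𝔻∞ → u ⊢𝔾𝔻 C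
  ⊢𝔾𝔻-intro D =
    lift ((λ n i → let (_ , j , e , _) = ⊢-declaredλ D i in j , e) ,
          (λ n i → let (_ , j , e , _) = ⊢-declaredμ D i in j , e)) ,
    ⊢-restrict D (λ n C i g → i , g) (λ n C i d → i , d)

  ⊢𝔾𝔻-elim : ∀ {u C} → u ⊢𝔾𝔻 C → 𝔾∞ ⊢ u ∶ C ∣ 𝔻∞
  ⊢𝔾𝔻-elim (_ , D) = ⊢-restrict D (λ n C i → proj₂) (λ n C i → proj₂)

  ⊢*-app : ∀ {t u C D} → t ⊢*𝔾𝔻 (C ⇒ D) → u ⊢*𝔾𝔻 C → app t u ⊢*𝔾𝔻 D
  ⊢*-app {t} {u} (t' , lift t▷t' , dt) (u' , lift u▷u' , du) =
    app t' u' ,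
    lift (gmap (λ a → app a u) appl t▷t' ◅◅ gmap (app t') appr u▷u') ,
    ⊢𝔾𝔻-intro (→e (⊢𝔾𝔻-elim dt) (⊢𝔾𝔻-elim du))

  ⊢*-var : ∀ {i C} → A i ≡ C → var (x i) ⊢*𝔾𝔻 C
  ⊢*-var {i} Ai = var (x i) , lift ε , ⊢𝔾𝔻-intro (ax (i , refl , Ai))

  𝔾∞-unique : ∀ {i C} → A i ≡ C → ∀ C' → 𝔾∞ (x i) C' → C' ≡ C
  𝔾∞-unique Ai C' (j , e , Aj) = trans (sym Aj) (trans (cong A (x-inj e)) Ai)

  ⊢*-unapply : ∀ {i C D t} → A i ≡ C → app t (var (x i)) ⊢*𝔾𝔻 D → t ⊢*𝔾𝔻 (C ⇒ D)
  ⊢*-unapply {C = C} Ai (w , lift red , dw) with unapply C (𝔾∞-unique Ai) red (⊢𝔾𝔻-elim dw)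
  ... | t' , t▷t' , dt = t' , lift t▷t' , ⊢𝔾𝔻-intro dt

  sound    : ∀ C t → t ⊢*𝔾𝔻 C → 𝕀 C t
  complete : ∀ C t → 𝕀 C t → t ⊢*𝔾𝔻 C

  sound (atom p) t h = h
  sound bot      t h = h
  sound (C ⇒ D)  t h u hu = sound D (app t u) (⊢*-app h (complete C u hu))

  complete (atom p) t h = h
  complete bot      t h = h
  complete (C ⇒ D)  t h with A-onto C
  ... | i , Ai = ⊢*-unapply Ai (complete D _ (h (var (x i)) (sound C _ (⊢*-var Ai))))

lemma3p9 : (x α : ℕ → ℕ) → Injective _≡_ _≡_ x → Injective _≡_ _≡_ α →
           (A B : ℕ → Ty) → (∀ C → ∃ λ i → A i ≡ C) → (∀ C → ∃ λ i → B i ≡ C) →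
           (C : Ty) (t : Tm) →
           (Setting._⊢*𝔾𝔻_ x α A B t C → Setting.𝕀 x α A B C t)
           × (Setting.𝕀 x α A B C t → Setting._⊢*𝔾𝔻_ x α A B t C)
lemma3p9 x α x-inj _ A B A-onto _ C t = sound C t , complete C t
  where open Adequacy x α x-inj A B A-onto
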